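{- Let $r \geq 1$. There is an injection \[ \psi = (\psi_1,\psi_2): S_{n,r}^*(21) \hookrightarrow [n] \times S^*_{n,r-1}(21) \] such that for every $p \in S^*_{n,r}(21)$, the permutation $\psi_2(p)$ is obtained from $p$ by swapping two of its entries, and every set of positions forming a copy of $21$ in $\psi_2(p)$ also forms a copy of $21$ in $p$ (i.e., the swap creates no new $21$ patterns).
   Context: A permutation $p$ contains an occurrence (copy) of a pattern $q = q_1\cdots q_k$ if there are indices $n_1 < \cdots < n_k$ with $p_{n_i} < p_{n_j}$ if and only if $q_i < q_j$; distinct index sequences count as distinct copies. $S^*_{n,r}(q)$ denotes the set of permutations of length $n$ which contain exactly $r$ copies of $q$ and such that no two of these $r$ copies have any entry in common. $[n]=\{1,\ldots,n\}$. -}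

module Defs where

open import Data.Nat using (ℕ)
open import Data.Fin using (Fin; _<_; _<?_)
open import Data.Fin.Permutation.Components using (transpose)
open import Data.Product using (_×_; _,_; Σ)
open import Data.List using (List; length; filter; allFin; cartesianProduct)
open import Relation.Binary.PropositionalEquality using (_≡_; _≢_)
open import Relation.Nullary using (¬_)
open import Relation.Nullary.Decidable using (_×-dec_)
open import Relation.Unary using (Decidable)
open import Function.Definitions using (Injective)

-- A permutation of length n: an injective (hence bijective) map [n] → [n],
-- position i ↦ entry p i (positions/values 0-indexed).
Perm : ℕ → Set
Perm n = Σ (Fin n → Fin n) (Injective _≡_ _≡_)

_≈ₚ_ : ∀ {n} → (Fin n → Fin n) → (Fin n → Fin n) → Set
p ≈ₚ q = ∀ i → p i ≡ q i

Copy21 : ∀ {n} → (Fin n → Fin n) → Fin n × Fin n → Set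
Copy21 p (i , j) = (i < j) × (p j < p i)

copy21? : ∀ {n} (p : Fin n → Fin n) → Decidable (Copy21 p)
copy21? p (i , j) = (i <? j) ×-dec (p j <? p i)

copies21 : ∀ {n} → (Fin n → Fin n) → List (Fin n × Fin n)
copies21 {n} p = filter (copy21? p) (cartesianProduct (allFin n) (allFin n))

count21 : ∀ {n} → (Fin n → Fin n) → ℕ
count21 p = length (copies21 p)

Disjoint21 : ∀ {n} → (Fin n → Fin n) → Set
Disjoint21 p = ∀ i j k l → Copy21 p (i , j) → Copy21 p (k , l) → ¬ ((i ≡ k) × (j ≡ l)) →
  (i ≢ k) × (i ≢ l) × (j ≢ k) × (j ≢ l)

S* : ℕ → ℕ → Set
S* n r = Σ (Perm n) λ p → (count21 (Data.Product.proj₁ p) ≡ r) × Disjoint21 (Data.Product.proj₁ p)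

perm : ∀ {n r} → S* n r → Fin n → Fin n
perm ((p , _) , _) = p

SwapOf : ∀ {n} → (Fin n → Fin n) → (Fin n → Fin n) → Set
SwapOf {n} p q = Σ (Fin n) λ a → Σ (Fin n) λ b → (a ≢ b) × (q ≈ₚ (λ k → p (transpose a b k)))

NoNew21 : ∀ {n} → (Fin n → Fin n) → (Fin n → Fin n) → Set
NoNew21 {n} p q = ∀ (i j : Fin n) → Copy21 q (i , j) → Copy21 p (i , j)

-- When the copies of 21 in p are pairwise disjoint, every copy (i , j) sits at
-- adjacent positions (an entry strictly between them would form a second copy
-- with i or with j), and no other copy touches positions i or j. Swapping the
-- two entries therefore destroys the copy (i , j) and leaves every other pair
-- untouched, so it lowers the number of copies by one and creates none.
-- Since j is the successor position of i, the pair (i , swapped permutation)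
-- determines p.
module Submission where

open import Defs
open import Data.Nat using (ℕ; suc; _≤_; _∸_)
import Data.Nat as ℕ
open import Data.Fin using (Fin; _<_; _≟_)
open import Data.Fin.Properties using (<-cmp; <-irrefl; <-asym; <-trans)
open import Data.Fin.Permutation.Components using (transpose; transpose-inverse)
open import Data.Product using (Σ; ∃; _×_; _,_; proj₁; proj₂)
open import Data.Sum using (_⊎_; inj₁; inj₂)
open import Data.Empty using (⊥-elim)
open import Data.List using (List; _∷_; length; filter; allFin; cartesianProduct)
open import Data.List.Properties using (filter-accept; filter-reject)
open import Data.List.Membership.Propositional using (_∈_)
open import Data.List.Membership.Propositional.Properties
  using (∈-filter⁻; ∈-cartesianProduct⁺; ∈-allFin)
open import Data.List.Relation.Unary.Any using (here; there)
open import Data.List.Relation.Unary.All as All using (All)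
open import Data.List.Relation.Unary.AllPairs using (_∷_)
open import Data.List.Relation.Unary.Unique.Propositional using (Unique)
open import Data.List.Relation.Unary.Unique.Propositional.Properties
  using (cartesianProduct⁺; allFin⁺)
open import Function using (_∘_)
open import Function.Definitions using (Injective)
open import Relation.Binary.PropositionalEquality
  using (_≡_; _≢_; refl; sym; trans; cong; subst; module ≡-Reasoning)
open import Relation.Binary.Definitions using (tri<; tri≈; tri>)
open import Relation.Nullary using (¬_; yes; no)
open import Relation.Nullary.Decidable using (dec-true; dec-false)
open import Relation.Unary using (Pred; Decidable)
open import Level using (0ℓ)

module _ {A : Set} {P Q : Pred A 0ℓ} (P? : Decidable P) (Q? : Decidable Q) {c : A}
         (P⇒Q : ∀ {x} → x ≢ c → P x → Q x) (Q⇒P : ∀ {x} → Q x → P x) where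

  filter-agree-off : ∀ {xs} → All (c ≢_) xs → filter P? xs ≡ filter Q? xs
  filter-agree-off {_}      All.[] = refl
  filter-agree-off {x ∷ xs} (c≢x All.∷ c∉xs) with P? x
  ... | yes Px = trans (cong (x ∷_) (filter-agree-off c∉xs))
                       (sym (filter-accept Q? (P⇒Q (c≢x ∘ sym) Px)))
  ... | no ¬Px = trans (filter-agree-off c∉xs) (sym (filter-reject Q? (¬Px ∘ Q⇒P)))

  length-filter-drop-one : P c → ¬ Q c → ∀ {xs} → Unique xs → c ∈ xs →
                           length (filter P? xs) ≡ suc (length (filter Q? xs))
  length-filter-drop-one Pc ¬Qc {c ∷ xs} (c∉xs ∷ _) (here refl)
    rewrite filter-accept P? {xs = xs} Pc | filter-reject Q? {xs = xs} ¬Qc =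
      cong (suc ∘ length) (filter-agree-off c∉xs)
  length-filter-drop-one Pc ¬Qc {x ∷ xs} (x∉xs ∷ u) (there c∈xs) with P? x
  ... | yes Px rewrite filter-accept Q? {xs = xs} (P⇒Q (All.lookup x∉xs c∈xs) Px) =
      cong suc (length-filter-drop-one Pc ¬Qc u c∈xs)
  ... | no ¬Px rewrite filter-reject Q? {xs = xs} (¬Px ∘ Q⇒P) =
      length-filter-drop-one Pc ¬Qc u c∈xs

∈-nonempty : {A : Set} {xs : List A} → 0 ℕ.< length xs → ∃ (_∈ xs)
∈-nonempty {xs = x ∷ _} _ = x , here refl

module _ {n : ℕ} (i j : Fin n) where

  transpose-matchˡ : transpose i j i ≡ j
  transpose-matchˡ rewrite dec-true (i ≟ i) refl = refl

  transpose-matchʳ : transpose i j j ≡ i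
  transpose-matchʳ with j ≟ i
  ... | yes j≡i = j≡i
  ... | no _ rewrite dec-true (j ≟ j) refl = refl

  transpose-noMatch : ∀ {k} → k ≢ i → k ≢ j → transpose i j k ≡ k
  transpose-noMatch {k} k≢i k≢j
    rewrite dec-false (k ≟ i) k≢i | dec-false (k ≟ j) k≢j = refl

  transpose-injective : Injective _≡_ _≡_ (transpose i j)
  transpose-injective e =
    trans (sym (transpose-inverse j i)) (trans (cong (transpose j i) e) (transpose-inverse j i))

  data Spot : Fin n → Set where
    at-i : Spot i
    at-j : Spot j
    away : ∀ {k} → k ≢ i → k ≢ j → Spot k

  spot : ∀ k → Spot k
  spot k with k ≟ i | k ≟ j
  ... | yes refl | _        = at-i
  ... | no _     | yes refl = at-j
  ... | no k≢i   | no k≢j   = away k≢i k≢j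

Adjacent : ∀ {n} → Fin n → Fin n → Set
Adjacent {n} i j = i < j × (∀ {k : Fin n} → i < k → ¬ k < j)

module _ {n : ℕ} {i j : Fin n} (adj : Adjacent i j) where

  adjacent-unique : ∀ {j′} → Adjacent i j′ → j ≡ j′
  adjacent-unique (i<j′ , gap′) with <-cmp j _
  ... | tri< j<j′ _ _ = ⊥-elim (gap′ (proj₁ adj) j<j′)
  ... | tri≈ _ j≡j′ _ = j≡j′
  ... | tri> _ _ j′<j = ⊥-elim (proj₂ adj i<j′ j′<j)

  adjacent-outside : ∀ {k} → k ≢ i → k ≢ j → k < i ⊎ j < k
  adjacent-outside {k} k≢i k≢j with <-cmp k i | <-cmp k j
  ... | tri< k<i _ _ | _            = inj₁ k<i
  ... | tri≈ _ k≡i _ | _            = ⊥-elim (k≢i k≡i)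
  ... | tri> _ _ i<k | tri< k<j _ _ = ⊥-elim (proj₂ adj i<k k<j)
  ... | tri> _ _ _   | tri≈ _ k≡j _ = ⊥-elim (k≢j k≡j)
  ... | tri> _ _ _   | tri> _ _ j<k = inj₂ j<k

module Swap {n : ℕ} {p : Fin n → Fin n} (p-inj : Injective _≡_ _≡_ p) (p-disj : Disjoint21 p)
            {i j : Fin n} (c : Copy21 p (i , j)) where

  q : Fin n → Fin n
  q = p ∘ transpose i j

  i<j : i < j
  i<j = proj₁ c

  pj<pi : p j < p i
  pj<pi = proj₂ c

  copy21-avoids : ∀ {a b} → Copy21 p (a , b) → (a , b) ≢ (i , j) →
                  (a ≢ i × a ≢ j) × (b ≢ i × b ≢ j)
  copy21-avoids c′ ab≢ij with p-disj i j _ _ c c′ (λ { (refl , refl) → ab≢ij refl })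
  ... | i≢a , i≢b , j≢a , j≢b = (i≢a ∘ sym , j≢a ∘ sym) , (i≢b ∘ sym , j≢b ∘ sym)

  copy21-adjacent : Adjacent i j
  copy21-adjacent = i<j , between
    where
    between : ∀ {k} → i < k → ¬ k < j
    between {k} i<k k<j with <-cmp (p k) (p i)
    ... | tri< pk<pi _ _ =
      proj₁ (proj₁ (copy21-avoids (i<k , pk<pi) λ { refl → <-irrefl refl k<j })) refl
    ... | tri≈ _ pk≡pi _ = <-irrefl (sym (p-inj pk≡pi)) i<k
    ... | tri> _ _ pi<pk =
      proj₂ (proj₂ (copy21-avoids (k<j , <-trans pj<pi pi<pk) λ { refl → <-irrefl refl i<k })) refl

  q-values : ∀ {a b a′ b′} → transpose i j a ≡ a′ → transpose i j b ≡ b′ →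
             Copy21 q (a , b) → p b′ < p a′
  q-values refl refl (_ , lt) = lt

  swap-removes : ¬ Copy21 q (i , j)
  swap-removes cq = <-asym pj<pi (q-values (transpose-matchˡ i j) (transpose-matchʳ i j) cq)

  -- Each mixed case yields a copy of 21 in p through i or j other than (i , j);
  -- adjacency puts the outside position on the right side of both i and j.
  swap-noNew21 : NoNew21 p q
  swap-noNew21 a b cq with spot i j a | spot i j b
  ... | at-i | at-i = ⊥-elim (<-irrefl refl (proj₁ cq))
  ... | at-i | at-j = ⊥-elim (swap-removes cq)
  ... | at-j | at-i = ⊥-elim (<-asym i<j (proj₁ cq))
  ... | at-j | at-j = ⊥-elim (<-irrefl refl (proj₁ cq))
  ... | at-i | away b≢i b≢j with adjacent-outside copy21-adjacent b≢i b≢j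
  ...   | inj₁ b<i = ⊥-elim (<-asym b<i (proj₁ cq))
  ...   | inj₂ j<b = ⊥-elim (proj₂ (proj₁ (copy21-avoids
            (j<b , q-values (transpose-matchˡ i j) (transpose-noMatch i j b≢i b≢j) cq)
            λ { refl → <-irrefl refl i<j })) refl)
  swap-noNew21 a b cq | at-j | away b≢i b≢j =
    ⊥-elim (proj₁ (proj₁ (copy21-avoids
      (<-trans i<j (proj₁ cq) , q-values (transpose-matchʳ i j) (transpose-noMatch i j b≢i b≢j) cq)
      λ e → b≢j (cong proj₂ e))) refl)
  swap-noNew21 a b cq | away a≢i a≢j | at-i =
    ⊥-elim (proj₂ (proj₂ (copy21-avoids
      (<-trans (proj₁ cq) i<j , q-values (transpose-noMatch i j a≢i a≢j) (transpose-matchˡ i j) cq)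
      λ e → a≢i (cong proj₁ e))) refl)
  swap-noNew21 a b cq | away a≢i a≢j | at-j with adjacent-outside copy21-adjacent a≢i a≢j
  ...   | inj₂ j<a = ⊥-elim (<-asym j<a (proj₁ cq))
  ...   | inj₁ a<i = ⊥-elim (proj₁ (proj₂ (copy21-avoids
            (a<i , q-values (transpose-noMatch i j a≢i a≢j) (transpose-matchʳ i j) cq)
            λ { refl → <-irrefl refl i<j })) refl)
  swap-noNew21 a b cq | away a≢i a≢j | away b≢i b≢j =
    proj₁ cq , q-values (transpose-noMatch i j a≢i a≢j) (transpose-noMatch i j b≢i b≢j) cq

  swap-keeps : ∀ {a b} → (a , b) ≢ (i , j) → Copy21 p (a , b) → Copy21 q (a , b)
  swap-keeps ab≢ij (a<b , pb<pa) with copy21-avoids (a<b , pb<pa) ab≢ij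
  ... | (a≢i , a≢j) , (b≢i , b≢j)
    rewrite transpose-noMatch i j a≢i a≢j | transpose-noMatch i j b≢i b≢j = a<b , pb<pa

  count21-swap : count21 p ≡ suc (count21 q)
  count21-swap =
    length-filter-drop-one (copy21? p) (copy21? q)
      (λ {x} → swap-keeps {proj₁ x} {proj₂ x}) (λ {x} → swap-noNew21 (proj₁ x) (proj₂ x))
      c swap-removes
      (cartesianProduct⁺ (allFin⁺ n) (allFin⁺ n))
      (∈-cartesianProduct⁺ (∈-allFin i) (∈-allFin j))

  q-inj : Injective _≡_ _≡_ q
  q-inj = transpose-injective i j ∘ p-inj

  q-disj : Disjoint21 q
  q-disj a b k l c₁ c₂ = p-disj a b k l (swap-noNew21 a b c₁) (swap-noNew21 k l c₂)

first-copy21 : ∀ {n} (p : Fin n → Fin n) → 0 ℕ.< count21 p → ∃ (Copy21 p)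
first-copy21 {n} p pos with x , x∈ ← ∈-nonempty pos =
  x , proj₂ (∈-filter⁻ (copy21? p) {xs = cartesianProduct (allFin n) (allFin n)} x∈)

removeCopy21 : ∀ {n r} (p : S* n r) {i j : Fin n} → Copy21 (perm p) (i , j) → S* n (r ∸ 1)
removeCopy21 ((p , p-inj) , count≡r , p-disj) c =
  (q , q-inj) , cong (_∸ 1) (trans (sym count21-swap) count≡r) , q-disj
  where open Swap p-inj p-disj c

removeCopy21-swap : ∀ {n r} (p : S* n r) {i j : Fin n} (c : Copy21 (perm p) (i , j)) →
                    SwapOf (perm p) (perm (removeCopy21 p c))
                    × NoNew21 (perm p) (perm (removeCopy21 p c))
removeCopy21-swap ((_ , p-inj) , _ , p-disj) {i} {j} c =
  (i , j , (λ { refl → <-irrefl refl (proj₁ c) }) , λ _ → refl)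
  , Swap.swap-noNew21 p-inj p-disj c

removeCopy21-injective :
  ∀ {n r} (p p′ : S* n r) {i j i′ j′ : Fin n}
  (c : Copy21 (perm p) (i , j)) (c′ : Copy21 (perm p′) (i′ , j′)) → i ≡ i′ →
  perm (removeCopy21 p c) ≈ₚ perm (removeCopy21 p′ c′) → perm p ≈ₚ perm p′
removeCopy21-injective ((p , p-inj) , _ , p-disj) ((p′ , p′-inj) , _ , p′-disj)
                       {i} {j} c c′ refl q≈q′ k
  with refl ← adjacent-unique (Swap.copy21-adjacent p-inj p-disj c)
                              (Swap.copy21-adjacent p′-inj p′-disj c′) =
  begin
    p k                                  ≡⟨ cong p (sym (transpose-inverse i j)) ⟩
    p (transpose i j (transpose j i k))  ≡⟨ q≈q′ (transpose j i k) ⟩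
    p′ (transpose i j (transpose j i k)) ≡⟨ cong p′ (transpose-inverse i j) ⟩
    p′ k                                 ∎
  where open ≡-Reasoning

lemma3p2 : (n r : ℕ) → 1 ≤ r →
    Σ (S* n r → Fin n × S* n (r ∸ 1)) λ ψ →
      ((p p′ : S* n r) → proj₁ (ψ p) ≡ proj₁ (ψ p′) →
        perm (proj₂ (ψ p)) ≈ₚ perm (proj₂ (ψ p′)) → perm p ≈ₚ perm p′)
      × ((p : S* n r) → SwapOf (perm p) (perm (proj₂ (ψ p)))
                      × NoNew21 (perm p) (perm (proj₂ (ψ p))))
lemma3p2 n r 1≤r = ψ , ψ-injective , ψ-swap
  where
  copy : (p : S* n r) → ∃ (Copy21 (perm p))
  copy ((p , _) , count≡r , _) = first-copy21 p (subst (1 ≤_) (sym count≡r) 1≤r)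

  ψ : S* n r → Fin n × S* n (r ∸ 1)
  ψ p = proj₁ (proj₁ (copy p)) , removeCopy21 p (proj₂ (copy p))

  ψ-injective : (p p′ : S* n r) → proj₁ (ψ p) ≡ proj₁ (ψ p′) →
                perm (proj₂ (ψ p)) ≈ₚ perm (proj₂ (ψ p′)) → perm p ≈ₚ perm p′
  ψ-injective p p′ = removeCopy21-injective p p′ (proj₂ (copy p)) (proj₂ (copy p′))

  ψ-swap : (p : S* n r) → SwapOf (perm p) (perm (proj₂ (ψ p)))
                        × NoNew21 (perm p) (perm (proj₂ (ψ p)))
  ψ-swap p = removeCopy21-swap p (proj₂ (copy p))
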